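{- (1) Let $\Delta$ be a connected simple graph (a pure strongly connected $1$-dimensional simplicial complex) on vertex set $[n]$, and assume the natural order on $[n]$ is an interval order for $\Delta$. Then ordering the edges of $\Delta$ lexicographically is a shelling of $\Delta$ (a lex shelling). (2) For every integer $d\ge 2$ there exists a pure, strongly connected, $d$-dimensional simplicial complex $\Delta$ on a vertex set $[n]$ such that the natural order on $[n]$ is an interval order for $\Delta$, but $\Delta$ is not shellable.
   Context: A simplicial complex is a family of finite sets closed under taking subsets; faces, dimension $|E|-1$, facets (maximal faces) and purity are as usual. For facets $F_1,\dots,F_k$, $\langle F_1,\dots,F_k\rangle$ denotes the complex of all subsets of the $F_i$. $\Delta$ is strongly connected if its dual graph (nodes = facets, edges between facets sharing a codimension-one face) is connected. The order on $[n]$ is an interval order for a pure $d$-dimensional complex $\Delta$ if whenever $\{v_0<v_1<\dots<v_d\}$ is a facet of $\Delta$, then every set $\{v_0<w_1<\dots<w_d\}$ with $w_i\le v_i$ for all $i\in[d]$ is also a facet of $\Delta$. A shelling of a pure $d$-dimensional complex is an ordering $F_1,\dots,F_m$ of its facets such that for every $k\in[m-1]$, $\langle F_{k+1}\rangle\cap\langle F_1,\dots,F_k\rangle$ is pure of dimension $d-1$; $\Delta$ is shellable if it has a shelling. A lex shelling is a shelling in which facets (written as increasing sequences) appear in lexicographic order. -}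

module Defs where

open import Data.Nat using (ℕ; suc; _≤_; _<_)
open import Data.List using (List; []; _∷_; _++_; length)
open import Data.List.Relation.Unary.All using (All)
open import Data.List.Relation.Unary.Any using (Any)
open import Data.List.Relation.Unary.Linked using (Linked)
open import Data.List.Relation.Unary.Unique.Propositional using (Unique)
open import Data.List.Membership.Propositional using (_∈_)
open import Data.List.Relation.Binary.Subset.Propositional using (_⊆_)
open import Data.List.Relation.Binary.Pointwise using (Pointwise)
open import Data.List.Relation.Binary.Lex.Strict using (Lex-<)
open import Data.List.Relation.Binary.Permutation.Propositional using (_↭_)
open import Relation.Binary.Construct.Closure.ReflexiveTransitive using (Star)
open import Relation.Binary.PropositionalEquality using (_≡_; _≢_)
open import Data.Product using (Σ; _×_; ∃)
open import Data.Unit using (⊤)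
open import Relation.Nullary using (¬_)

-- Conventions: vertices are natural numbers; [n] = {1,…,n}.
-- A finite set of vertices (a face) is written as a strictly increasing list.
StrictIncr : List ℕ → Set
StrictIncr = Linked _<_

-- The complex itself is
-- the family of all subsets of the facets (⟨F₁,…,Fₘ⟩).  Since all facets have
-- the same size and are distinct, they are exactly the maximal faces.
record PureComplex (n d : ℕ) : Set where
  field
    facets   : List (List ℕ)
    nonempty : facets ≢ []
    distinct : Unique facets
    increasing : All StrictIncr facets
    size     : All (λ F → length F ≡ suc d) facets
    inRange  : All (All (λ v → 1 ≤ v × v ≤ n)) facets
open PureComplex public

Adjacent : ℕ → List ℕ → List ℕ → Set
Adjacent d F G = Σ (List ℕ) λ H → StrictIncr H × H ⊆ F × H ⊆ G × length H ≡ d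

DualEdge : ∀ {n d} → PureComplex n d → List ℕ → List ℕ → Set
DualEdge {d = d} Δ F G = F ∈ facets Δ × G ∈ facets Δ × Adjacent d F G

StronglyConnected : ∀ {n d} → PureComplex n d → Set
StronglyConnected Δ =
  ∀ F G → F ∈ facets Δ → G ∈ facets Δ → Star (DualEdge Δ) F G

IntervalOrder : ∀ {n d} → PureComplex n d → Set
IntervalOrder Δ =
  ∀ v₀ vs ws → (v₀ ∷ vs) ∈ facets Δ → StrictIncr (v₀ ∷ ws) →
  Pointwise _≤_ ws vs → (v₀ ∷ ws) ∈ facets Δ

IntFace : List (List ℕ) → List ℕ → List ℕ → Set
IntFace prev F G = StrictIncr G × G ⊆ F × Any (λ H → G ⊆ H) prev

PureIntersection : ℕ → List (List ℕ) → List ℕ → Set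
PureIntersection d prev F =
  (∀ G → IntFace prev F G → length G ≤ d) ×
  (∀ G → IntFace prev F G →
     Σ (List ℕ) λ H → IntFace prev F H × G ⊆ H × length H ≡ d)

ShellingFrom : ℕ → List (List ℕ) → List (List ℕ) → Set
ShellingFrom d prev []         = ⊤
ShellingFrom d prev (F ∷ rest) =
  PureIntersection d prev F × ShellingFrom d (prev ++ (F ∷ [])) rest

IsShellingOrder : ℕ → List (List ℕ) → Set
IsShellingOrder d []       = ⊤
IsShellingOrder d (F ∷ Fs) = ShellingFrom d (F ∷ []) Fs

IsShelling : ∀ {n d} → PureComplex n d → List (List ℕ) → Set
IsShelling {d = d} Δ Fs = Fs ↭ facets Δ × IsShellingOrder d Fs

Shellable : ∀ {n d} → PureComplex n d → Set
Shellable Δ = ∃ λ Fs → IsShelling Δ Fs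

LexLess : List ℕ → List ℕ → Set
LexLess = Lex-< _≡_ _<_

LexOrdered : List (List ℕ) → Set
LexOrdered = Linked LexLess

{-# OPTIONS --safe #-}
-- (1) In the lex order an edge {a < b} can only meet earlier edges in vertices, and the vertex a
-- does lie on an earlier edge: either some earlier edge starts at a, or an earlier edge starts
-- below a, and a walk in the connected graph from it to {a, b} passes an edge {x < y} with
-- x < a ≤ y, which the interval order turns into the earlier edge {x, a}.
-- (2) On [2d+1] take the fans {1,…,d,k} (d < k ≤ 2d+1), all sharing the ridge {1,…,d}, and the
-- windows {i,…,i+d} (2 ≤ i ≤ d+1), a path of ridges starting at the fan {1,…,d+1}. The vertex
-- 2d+1 lies only on the last fan and the last window, which meet in that vertex alone; whichever
-- of the two comes second in a shelling meets its predecessors in a complex that is not pure.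
module Submission where

open import Defs
open import Data.Nat using (ℕ; zero; suc; _+_; _≤_; _<_; z≤n; s≤s; _≟_; _<?_)
open import Data.Nat.Properties as ℕ using (≤-refl; ≤-trans; <⇒≤; <⇒≱; <-irrefl)
open import Data.List using (List; []; _∷_; _++_; _∷ʳ_; [_]; length; map)
open import Data.List.Properties using (++-assoc; ++-identityʳ; length-++; ∷-injectiveˡ; ∷ʳ-injectiveʳ)
open import Data.List.Relation.Unary.All as All using (All; []; _∷_)
open import Data.List.Relation.Unary.Any using (here; there)
open import Data.List.Relation.Unary.AllPairs as AllPairs using (AllPairs; _∷_)
open import Data.List.Relation.Unary.Linked using (Linked; []; [-]; _∷_)
open import Data.List.Relation.Unary.Linked.Properties using (Linked⇒AllPairs)
open import Data.List.Relation.Unary.Unique.Propositional using (Unique)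
import Data.List.Relation.Unary.Unique.Propositional.Properties as Unique
open import Data.List.Membership.Propositional using (_∈_; _∉_; find; lose)
open import Data.List.Membership.Propositional.Properties
  using (∈-++⁺ˡ; ∈-++⁺ʳ; ∈-++⁻; ∈-insert; ∈-∃++; ∈-map⁺; ∈-map⁻)
open import Data.List.Relation.Binary.Subset.Propositional using (_⊆_)
open import Data.List.Relation.Binary.Pointwise using (Pointwise; []; _∷_)
open import Data.List.Relation.Binary.Lex.Core using (this; next)
open import Data.List.Relation.Binary.Lex.Strict using (<-strictPartialOrder)
open import Data.List.Relation.Binary.Permutation.Propositional using (_↭_; ↭-sym; ↭⇒↭ₛ)
open import Data.List.Relation.Binary.Permutation.Propositional.Properties using (∈-resp-↭)
import Data.List.Relation.Binary.Permutation.Setoid.Properties as PermutationSetoid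
open import Relation.Binary.Bundles using (StrictPartialOrder)
open import Relation.Binary.Core using (Rel)
open import Relation.Binary.Definitions using (Transitive; Asymmetric)
open import Relation.Binary.Construct.Closure.ReflexiveTransitive using (Star; ε; _◅_; _◅◅_; reverse)
open import Relation.Binary.PropositionalEquality using (module ≡-Reasoning; setoid; _≡_; _≢_; refl; sym; trans; cong; subst)
open import Data.Product using (Σ; ∃; ∃₂; _×_; _,_; proj₁)
open import Data.Sum using (_⊎_; inj₁; inj₂; [_,_]′; swap)
open import Data.Empty using (⊥; ⊥-elim)
open import Data.Unit using (tt)
open import Function using (_∘_; flip)
open import Relation.Nullary using (¬_; yes; no)

module _ {a ℓ} {A : Set a} {R : Rel A ℓ} where

  ∈-prefix⇒R : ∀ xs {y ys z} → AllPairs R (xs ++ y ∷ ys) → z ∈ xs → R z y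
  ∈-prefix⇒R (x ∷ xs) (Rx ∷ _) (here refl) = All.lookup Rx (∈-++⁺ʳ xs (here refl))
  ∈-prefix⇒R (x ∷ xs) (_ ∷ sorted) (there z∈xs) = ∈-prefix⇒R xs sorted z∈xs

  R⇒∈-prefix : Asymmetric R → ∀ xs {y ys z} → AllPairs R (xs ++ y ∷ ys) →
               z ∈ xs ++ y ∷ ys → R z y → z ∈ xs
  R⇒∈-prefix asym [] _ (here refl) Rzy = ⊥-elim (asym Rzy Rzy)
  R⇒∈-prefix asym [] (Ry ∷ _) (there z∈ys) Rzy = ⊥-elim (asym Rzy (All.lookup Ry z∈ys))
  R⇒∈-prefix asym (x ∷ xs) _ (here refl) _ = here refl
  R⇒∈-prefix asym (x ∷ xs) (_ ∷ sorted) (there z∈) Rzy = there (R⇒∈-prefix asym xs sorted z∈ Rzy)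

one-before-other : ∀ {a} {A : Set a} {X Y : A} {L : List A} → X ≢ Y → X ∈ L → Y ∈ L →
  (∃₂ λ xs ys → L ≡ xs ++ Y ∷ ys × X ∈ xs) ⊎ (∃₂ λ xs ys → L ≡ xs ++ X ∷ ys × Y ∈ xs)
one-before-other X≢Y (here refl) (here refl) = ⊥-elim (X≢Y refl)
one-before-other X≢Y (here refl) (there Y∈L) with ∈-∃++ Y∈L
... | xs , ys , refl = inj₁ (_ ∷ xs , ys , refl , here refl)
one-before-other X≢Y (there X∈L) (here refl) with ∈-∃++ X∈L
... | xs , ys , refl = inj₂ (_ ∷ xs , ys , refl , here refl)
one-before-other X≢Y (there X∈L) (there Y∈L) with one-before-other X≢Y X∈L Y∈L
... | inj₁ (xs , ys , refl , X∈xs) = inj₁ (_ ∷ xs , ys , refl , there X∈xs)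
... | inj₂ (xs , ys , refl , Y∈xs) = inj₂ (_ ∷ xs , ys , refl , there Y∈xs)

lex-trans : Transitive LexLess
lex-trans = StrictPartialOrder.trans (<-strictPartialOrder ℕ.<-strictPartialOrder)

lex-asym : Asymmetric LexLess
lex-asym = StrictPartialOrder.asym (<-strictPartialOrder ℕ.<-strictPartialOrder)

lex-irrefl : ∀ {X} → ¬ LexLess X X
lex-irrefl X<X = lex-asym X<X X<X

module _ (d : ℕ) where

  shellingFrom⁺ : ∀ prev rest →
    (∀ xs F ys → rest ≡ xs ++ F ∷ ys → PureIntersection d (prev ++ xs) F) →
    ShellingFrom d prev rest
  shellingFrom⁺ prev [] _ = tt
  shellingFrom⁺ prev (F ∷ rest) pure =
    subst (λ p → PureIntersection d p F) (++-identityʳ prev) (pure [] F rest refl) ,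
    shellingFrom⁺ (prev ++ [ F ]) rest λ xs G ys eq →
      subst (λ p → PureIntersection d p G) (sym (++-assoc prev [ F ] xs))
            (pure (F ∷ xs) G ys (cong (F ∷_) eq))

  shellingFrom⁻ : ∀ prev xs {F ys} → ShellingFrom d prev (xs ++ F ∷ ys) →
                  PureIntersection d (prev ++ xs) F
  shellingFrom⁻ prev [] {F} (pure , _) =
    subst (λ p → PureIntersection d p F) (sym (++-identityʳ prev)) pure
  shellingFrom⁻ prev (x ∷ xs) {F} (_ , shelling) =
    subst (λ p → PureIntersection d p F) (++-assoc prev [ x ] xs)
          (shellingFrom⁻ (prev ++ [ x ]) xs shelling)

  isShellingOrder⁺ : ∀ Fs →
    (∀ P xs F ys → Fs ≡ P ∷ xs ++ F ∷ ys → PureIntersection d (P ∷ xs) F) →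
    IsShellingOrder d Fs
  isShellingOrder⁺ [] _ = tt
  isShellingOrder⁺ (P ∷ rest) pure =
    shellingFrom⁺ [ P ] rest λ xs F ys eq → pure P xs F ys (cong (P ∷_) eq)

  isShellingOrder⁻ : ∀ P xs {F ys} → IsShellingOrder d (P ∷ xs ++ F ∷ ys) →
                     PureIntersection d (P ∷ xs) F
  isShellingOrder⁻ P xs = shellingFrom⁻ [ P ] xs

∈-pair⁻ : ∀ {h u w : ℕ} → h ∈ u ∷ w ∷ [] → h ≡ u ⊎ h ≡ w
∈-pair⁻ (here refl) = inj₁ refl
∈-pair⁻ (there (here refl)) = inj₂ refl

pair-min : ∀ {h u w : ℕ} → u < w → h ∈ u ∷ w ∷ [] → u ≤ h
pair-min u<w h∈uw = [ (λ { refl → ≤-refl }) , (λ { refl → <⇒≤ u<w }) ]′ (∈-pair⁻ h∈uw)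

length≡1⇒∈ : ∀ {a} {A : Set a} (H : List A) → length H ≡ 1 → ∃ (_∈ H)
length≡1⇒∈ (h ∷ []) _ = h , here refl

module Graph {n} (Δ : PureComplex n 1) where

  edge-shape : ∀ {X} → X ∈ facets Δ → ∃₂ λ u w → X ≡ u ∷ w ∷ [] × u < w
  edge-shape X∈Δ = pair (All.lookup (size Δ) X∈Δ) (All.lookup (increasing Δ) X∈Δ)
    where
    pair : ∀ {X} → length X ≡ 2 → StrictIncr X → ∃₂ λ u w → X ≡ u ∷ w ∷ [] × u < w
    pair {[]} ()
    pair {_ ∷ []} ()
    pair {u ∷ w ∷ []} _ (u<w ∷ _) = u , w , refl , u<w
    pair {_ ∷ _ ∷ _ ∷ _} ()

  edge-through : ∀ {g₁ g₂ X} → g₁ < g₂ → X ∈ facets Δ → g₁ ∈ X → g₂ ∈ X → X ≡ g₁ ∷ g₂ ∷ []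
  edge-through g₁<g₂ X∈Δ g₁∈X g₂∈X with edge-shape X∈Δ
  ... | u , w , refl , u<w with ∈-pair⁻ g₁∈X | ∈-pair⁻ g₂∈X
  ... | inj₁ refl | inj₁ refl = ⊥-elim (<-irrefl refl g₁<g₂)
  ... | inj₁ refl | inj₂ refl = refl
  ... | inj₂ refl | inj₁ refl = ⊥-elim (ℕ.<-asym u<w g₁<g₂)
  ... | inj₂ refl | inj₂ refl = ⊥-elim (<-irrefl refl g₁<g₂)

  CrossingEdge : ℕ → Set
  CrossingEdge a = ∃₂ λ x y → x ∷ y ∷ [] ∈ facets Δ × x < a × a ≤ y

  -- The first edge of the walk whose successor lies entirely in [a, ∞) crosses a:
  -- the vertex it shares with that successor is its upper endpoint.
  crossing-on-walk : ∀ {a u w Y} → Star (DualEdge Δ) (u ∷ w ∷ []) Y → u < a →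
                     All (a ≤_) Y → CrossingEdge a
  crossing-on-walk ε u<a (a≤u ∷ _) = ⊥-elim (<⇒≱ u<a a≤u)
  crossing-on-walk {a} {u} {w} ((uw∈Δ , Z∈Δ , H , _ , H⊆uw , H⊆Z , |H|≡1) ◅ walk) u<a a≤Y
    with edge-shape Z∈Δ
  ... | u′ , w′ , refl , u′<w′ with u′ <? a
  ... | yes u′<a = crossing-on-walk walk u′<a a≤Y
  ... | no u′≮a with length≡1⇒∈ H |H|≡1
  ... | h , h∈H with ∈-pair⁻ (H⊆uw h∈H) | ≤-trans (ℕ.≮⇒≥ u′≮a) (pair-min u′<w′ (H⊆Z h∈H))
  ... | inj₁ refl | a≤u = ⊥-elim (<⇒≱ u<a a≤u)
  ... | inj₂ refl | a≤w = u , w , uw∈Δ , u<a , a≤w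

  smaller-edge-through-min : StronglyConnected Δ → IntervalOrder Δ →
    ∀ {a b P} → a ∷ b ∷ [] ∈ facets Δ → P ∈ facets Δ → LexLess P (a ∷ b ∷ []) →
    ∃ λ X → X ∈ facets Δ × LexLess X (a ∷ b ∷ []) × a ∈ X
  smaller-edge-through-min sc io ab∈Δ P∈Δ P<ab with edge-shape P∈Δ | edge-shape ab∈Δ
  ... | p , q , refl , _ | _ , _ , refl , a<b with P<ab
  ... | next refl q<b = _ , P∈Δ , next refl q<b , here refl
  ... | this p<a with crossing-on-walk (sc _ _ P∈Δ ab∈Δ) p<a (≤-refl ∷ <⇒≤ a<b ∷ [])
  ... | x , y , xy∈Δ , x<a , a≤y =
    _ , io x [ y ] [ _ ] xy∈Δ (x<a ∷ [-]) (a≤y ∷ []) , this x<a , there (here refl)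

  record FacetsBelow (F : List ℕ) (prev : List (List ℕ)) : Set where
    field
      facet    : ∀ {X} → X ∈ prev → X ∈ facets Δ
      below    : ∀ {X} → X ∈ prev → LexLess X F
      complete : ∀ {X} → X ∈ facets Δ → LexLess X F → X ∈ prev

  pureIntersection : StronglyConnected Δ → IntervalOrder Δ → ∀ {F P prev} →
    F ∈ facets Δ → P ∈ prev → FacetsBelow F prev → PureIntersection 1 prev F
  pureIntersection sc io {prev = prev} F∈Δ P∈prev prev-below with edge-shape F∈Δ
  ... | a , b , refl , a<b = noEdge , extend
    where
    open FacetsBelow prev-below
    noEdge : ∀ G → IntFace prev (a ∷ b ∷ []) G → length G ≤ 1
    noEdge [] _ = z≤n
    noEdge (_ ∷ []) _ = s≤s z≤n
    noEdge (g₁ ∷ g₂ ∷ _) (g₁<g₂ ∷ _ , G⊆F , G⊆prev) with find G⊆prev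
    ... | H , H∈prev , G⊆H
      with edge-through g₁<g₂ (facet H∈prev) (G⊆H (here refl)) (G⊆H (there (here refl)))
         | edge-through g₁<g₂ F∈Δ (G⊆F (here refl)) (G⊆F (there (here refl)))
    ... | refl | refl = ⊥-elim (lex-irrefl (below H∈prev))
    extend : ∀ G → IntFace prev (a ∷ b ∷ []) G →
             ∃ λ H → IntFace prev (a ∷ b ∷ []) H × G ⊆ H × length H ≡ 1
    extend [] _ with smaller-edge-through-min sc io F∈Δ (facet P∈prev) (below P∈prev)
    ... | X , X∈Δ , X<F , a∈X =
      [ a ] , ([-] , (λ { (here refl) → here refl }) , lose (complete X∈Δ X<F) λ { (here refl) → a∈X }) ,
      (λ ()) , refl
    extend (g ∷ []) G∈ = [ g ] , G∈ , (λ g∈ → g∈) , refl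
    extend (_ ∷ _ ∷ _) G∈ with noEdge _ G∈
    ... | s≤s ()

lex-order-shells-graph : (n : ℕ) (Δ : PureComplex n 1) → StronglyConnected Δ → IntervalOrder Δ →
  (Fs : List (List ℕ)) → Fs ↭ facets Δ → LexOrdered Fs → IsShelling Δ Fs
lex-order-shells-graph n Δ sc io Fs Fs↭Δ sorted = Fs↭Δ , isShellingOrder⁺ 1 Fs pure
  where
  open Graph Δ
  pure : ∀ P xs F ys → Fs ≡ P ∷ xs ++ F ∷ ys → PureIntersection 1 (P ∷ xs) F
  pure P xs F ys eq = pureIntersection sc io (facet (∈-insert (P ∷ xs))) (here refl) record
    { facet    = facet ∘ ∈-++⁺ˡ
    ; below    = ∈-prefix⇒R (P ∷ xs) ordered
    ; complete = λ X∈Δ → R⇒∈-prefix lex-asym (P ∷ xs) ordered (∈-resp-↭ (↭-sym Fs↭Δ′) X∈Δ)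
    }
    where
    Fs↭Δ′ : P ∷ xs ++ F ∷ ys ↭ facets Δ
    Fs↭Δ′ = subst (_↭ facets Δ) eq Fs↭Δ
    facet : ∀ {X} → X ∈ P ∷ xs ++ F ∷ ys → X ∈ facets Δ
    facet = ∈-resp-↭ Fs↭Δ′
    ordered : AllPairs LexLess (P ∷ xs ++ F ∷ ys)
    ordered = Linked⇒AllPairs lex-trans (subst LexOrdered eq sorted)

strictIncr-⊆-singleton : ∀ {v H} → StrictIncr H → H ⊆ [ v ] → length H ≤ 1
strictIncr-⊆-singleton {H = []} _ _ = z≤n
strictIncr-⊆-singleton {H = _ ∷ []} _ _ = s≤s z≤n
strictIncr-⊆-singleton {H = _ ∷ _ ∷ _} (h₁<h₂ ∷ _) H⊆v with H⊆v (here refl) | H⊆v (there (here refl))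
... | here refl | here refl = ⊥-elim (<-irrefl refl h₁<h₂)

-- The face {v} of ⟨Y⟩ ∩ ⟨prev⟩ could only extend to a ridge inside X ∩ Y = {v}.
pinched-not-pure : ∀ {d v X Y prev} → 2 ≤ d → X ∈ prev → Y ∉ prev →
  (∀ {Z} → Z ∈ prev → v ∈ Z → Z ≡ X ⊎ Z ≡ Y) → v ∈ X → v ∈ Y →
  (∀ {x} → x ∈ X → x ∈ Y → x ≡ v) → ¬ PureIntersection d prev Y
pinched-not-pure 2≤d X∈prev Y∉prev only v∈X v∈Y X∩Y⊆v (_ , extend)
  with extend [ _ ] ([-] , (λ { (here refl) → v∈Y }) , lose X∈prev λ { (here refl) → v∈X })
... | H , (H↑ , H⊆Y , H⊆prev) , v⊆H , |H|≡d with find H⊆prev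
... | Z , Z∈prev , H⊆Z with only Z∈prev (H⊆Z (v⊆H (here refl)))
... | inj₂ refl = Y∉prev Z∈prev
... | inj₁ refl = <⇒≱ 2≤d (subst (_≤ 1) |H|≡d (strictIncr-⊆-singleton H↑ H⊆v))
  where
  H⊆v : H ⊆ [ _ ]
  H⊆v h∈H = here (X∩Y⊆v (H⊆Z h∈H) (H⊆Y h∈H))

pinched-¬isShellingOrder : ∀ {d v X Y} xs {ys} → 2 ≤ d → Unique (xs ++ Y ∷ ys) →
  IsShellingOrder d (xs ++ Y ∷ ys) → X ∈ xs → (∀ {Z} → Z ∈ xs → v ∈ Z → Z ≡ X ⊎ Z ≡ Y) →
  v ∈ X → v ∈ Y → (∀ {x} → x ∈ X → x ∈ Y → x ≡ v) → ⊥
pinched-¬isShellingOrder (P ∷ xs) 2≤d unique shelling X∈xs only v∈X v∈Y X∩Y⊆v =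
  pinched-not-pure 2≤d X∈xs (λ Y∈xs → ∈-prefix⇒R (P ∷ xs) unique Y∈xs refl) only v∈X v∈Y X∩Y⊆v
    (isShellingOrder⁻ _ P xs shelling)

↭-unique : ∀ {a} {A : Set a} {xs ys : List A} → xs ↭ ys → Unique ys → Unique xs
↭-unique {A = A} xs↭ys = PermutationSetoid.Unique-resp-↭ (setoid A) (↭⇒↭ₛ (↭-sym xs↭ys))

pinched⇒¬shellable : ∀ {n d v X Y} (Δ : PureComplex n d) → 2 ≤ d →
  X ∈ facets Δ → Y ∈ facets Δ → X ≢ Y → (∀ {Z} → Z ∈ facets Δ → v ∈ Z → Z ≡ X ⊎ Z ≡ Y) →
  v ∈ X → v ∈ Y → (∀ {x} → x ∈ X → x ∈ Y → x ≡ v) → ¬ Shellable Δ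
pinched⇒¬shellable Δ 2≤d X∈Δ Y∈Δ X≢Y only v∈X v∈Y X∩Y⊆v (Fs , Fs↭Δ , shelling)
  with one-before-other X≢Y (∈-resp-↭ (↭-sym Fs↭Δ) X∈Δ) (∈-resp-↭ (↭-sym Fs↭Δ) Y∈Δ)
... | inj₁ (xs , _ , refl , X∈xs) =
  pinched-¬isShellingOrder xs 2≤d (↭-unique Fs↭Δ (distinct Δ)) shelling X∈xs
    (λ Z∈xs → only (∈-resp-↭ Fs↭Δ (∈-++⁺ˡ Z∈xs))) v∈X v∈Y X∩Y⊆v
... | inj₂ (xs , _ , refl , Y∈xs) =
  pinched-¬isShellingOrder xs 2≤d (↭-unique Fs↭Δ (distinct Δ)) shelling Y∈xs
    (λ Z∈xs v∈Z → swap (only (∈-resp-↭ Fs↭Δ (∈-++⁺ˡ Z∈xs)) v∈Z)) v∈Y v∈X (flip X∩Y⊆v)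

consecutive : ℕ → ℕ → List ℕ
consecutive a zero = []
consecutive a (suc m) = a ∷ consecutive (suc a) m

∈-consecutive⁻ : ∀ a m {x} → x ∈ consecutive a m → a ≤ x × x < a + m
∈-consecutive⁻ a (suc m) (here refl) = ≤-refl , ℕ.m<m+n a (s≤s z≤n)
∈-consecutive⁻ a (suc m) {x} (there x∈) with ∈-consecutive⁻ (suc a) m x∈
... | a<x , x<a+1+m = <⇒≤ a<x , subst (x <_) (sym (ℕ.+-suc a m)) x<a+1+m

∈-consecutive⁺ : ∀ a m {x} → a ≤ x → x < a + m → x ∈ consecutive a m
∈-consecutive⁺ a zero a≤x x<a+0 = ⊥-elim (<⇒≱ (subst (_ <_) (ℕ.+-identityʳ a) x<a+0) a≤x)
∈-consecutive⁺ a (suc m) {x} a≤x x<a+m with x ≟ a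
... | yes refl = here refl
... | no x≢a = there (∈-consecutive⁺ (suc a) m (ℕ.≤∧≢⇒< a≤x (x≢a ∘ sym))
                                              (subst (x <_) (ℕ.+-suc a m) x<a+m))

length-consecutive : ∀ a m → length (consecutive a m) ≡ m
length-consecutive a zero = refl
length-consecutive a (suc m) = cong suc (length-consecutive (suc a) m)

consecutive-increasing : ∀ a m → StrictIncr (consecutive a m)
consecutive-increasing a zero = []
consecutive-increasing a (suc zero) = [-]
consecutive-increasing a (suc (suc m)) = ≤-refl ∷ consecutive-increasing (suc a) (suc m)

consecutive-∷ʳ-increasing : ∀ a m {k} → a + m ≤ k → StrictIncr (consecutive a m ∷ʳ k)
consecutive-∷ʳ-increasing a zero _ = [-]
consecutive-∷ʳ-increasing a (suc zero) {k} a+1≤k = subst (_≤ k) (ℕ.+-comm a 1) a+1≤k ∷ [-]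
consecutive-∷ʳ-increasing a (suc (suc m)) {k} a+m≤k =
  ≤-refl ∷ consecutive-∷ʳ-increasing (suc a) (suc m) (subst (_≤ k) (ℕ.+-suc a (suc m)) a+m≤k)

consecutive-∷ʳ : ∀ a m → consecutive a m ∷ʳ (a + m) ≡ consecutive a (suc m)
consecutive-∷ʳ a zero = cong [_] (ℕ.+-identityʳ a)
consecutive-∷ʳ a (suc m) =
  cong (a ∷_) (trans (cong (consecutive (suc a) m ∷ʳ_) (ℕ.+-suc a m)) (consecutive-∷ʳ (suc a) m))

consecutive-⊆-suc : ∀ a m → consecutive a m ⊆ consecutive a (suc m)
consecutive-⊆-suc a (suc m) (here refl) = here refl
consecutive-⊆-suc a (suc m) (there x∈) = there (consecutive-⊆-suc (suc a) m x∈)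

consecutive-forced : ∀ a m {ws} → Linked _<_ (a ∷ ws) → Pointwise _≤_ ws (consecutive (suc a) m) →
                     ws ≡ consecutive (suc a) m
consecutive-forced a zero _ [] = refl
consecutive-forced a (suc m) (a<w ∷ ws↑) (w≤a+1 ∷ ws≤) with ℕ.≤-antisym w≤a+1 a<w
... | refl = cong (suc a ∷_) (consecutive-forced (suc a) m ws↑ ws≤)

consecutive-∷ʳ-forced : ∀ a m {k ws} → Linked _<_ (a ∷ ws) →
  Pointwise _≤_ ws (consecutive (suc a) m ∷ʳ k) →
  ∃ λ w → ws ≡ consecutive (suc a) m ∷ʳ w × a + m < w × w ≤ k
consecutive-∷ʳ-forced a zero (a<w ∷ _) (w≤k ∷ []) =
  _ , refl , subst (_< _) (sym (ℕ.+-identityʳ a)) a<w , w≤k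
consecutive-∷ʳ-forced a (suc m) (a<w ∷ ws↑) (w≤a+1 ∷ ws≤) with ℕ.≤-antisym w≤a+1 a<w
... | refl with consecutive-∷ʳ-forced (suc a) m ws↑ ws≤
... | w , refl , a+1+m<w , w≤k = w , refl , subst (_< w) (sym (ℕ.+-suc a m)) a+1+m<w , w≤k

consecutive-unique : ∀ a m → Unique (consecutive a m)
consecutive-unique a m = AllPairs.map ℕ.<⇒≢ (Linked⇒AllPairs ℕ.<-trans (consecutive-increasing a m))

DualEdge-sym : ∀ {n d} {Δ : PureComplex n d} {X Y} → DualEdge Δ X Y → DualEdge Δ Y X
DualEdge-sym (X∈Δ , Y∈Δ , H , H↑ , H⊆X , H⊆Y , |H|≡d) = Y∈Δ , X∈Δ , H , H↑ , H⊆Y , H⊆X , |H|≡d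

module Counterexample (e : ℕ) where

  d : ℕ
  d = suc e

  apex : ℕ
  apex = d + suc d

  d<apex : d < apex
  d<apex = ℕ.m≤n+m (suc d) d

  fan : ℕ → List ℕ
  fan k = consecutive 1 d ∷ʳ k

  window : ℕ → List ℕ
  window i = consecutive i (suc d)

  data IsFacet : List ℕ → Set where
    fan⁺    : ∀ {k} → d < k → k ≤ apex → IsFacet (fan k)
    window⁺ : ∀ {i} → 2 ≤ i → i ≤ suc d → IsFacet (window i)

  fans windows facetList : List (List ℕ)
  fans = map fan (consecutive (suc d) (suc d))
  windows = map window (consecutive 2 d)
  facetList = fans ++ windows

  ∈-facetList⁺ : ∀ {X} → IsFacet X → X ∈ facetList
  ∈-facetList⁺ (fan⁺ d<k k≤apex) =
    ∈-++⁺ˡ (∈-map⁺ fan (∈-consecutive⁺ (suc d) (suc d) d<k (s≤s k≤apex)))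
  ∈-facetList⁺ (window⁺ 2≤i i≤d+1) =
    ∈-++⁺ʳ fans (∈-map⁺ window (∈-consecutive⁺ 2 d 2≤i (s≤s i≤d+1)))

  ∈-facetList⁻ : ∀ {X} → X ∈ facetList → IsFacet X
  ∈-facetList⁻ X∈Δ with ∈-++⁻ fans X∈Δ
  ... | inj₁ X∈fans with ∈-map⁻ fan X∈fans
  ... | k , k∈ , refl with ∈-consecutive⁻ (suc d) (suc d) k∈
  ... | d<k , k<2d+2 = fan⁺ d<k (ℕ.≤-pred k<2d+2)
  ∈-facetList⁻ X∈Δ | inj₂ X∈windows with ∈-map⁻ window X∈windows
  ... | i , i∈ , refl with ∈-consecutive⁻ 2 d i∈
  ... | 2≤i , i<d+2 = window⁺ 2≤i (ℕ.≤-pred i<d+2)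

  ∈-fan⁻ : ∀ {k x} → x ∈ fan k → (1 ≤ x × x ≤ d) ⊎ x ≡ k
  ∈-fan⁻ x∈fan with ∈-++⁻ (consecutive 1 d) x∈fan
  ... | inj₁ x∈ridge with ∈-consecutive⁻ 1 d x∈ridge
  ... | 1≤x , x<d+1 = inj₁ (1≤x , ℕ.≤-pred x<d+1)
  ∈-fan⁻ x∈fan | inj₂ (here refl) = inj₂ refl

  fans-windows-disjoint : ∀ {X} → ¬ (X ∈ fans × X ∈ windows)
  fans-windows-disjoint (X∈fans , X∈windows) with ∈-map⁻ fan X∈fans | ∈-map⁻ window X∈windows
  ... | _ , _ , refl | i , i∈ , fan≡window with ∈-consecutive⁻ 2 d i∈ | ∷-injectiveˡ fan≡window
  ... | 2≤1 , _ | refl = <-irrefl refl 2≤1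

  facetList-unique : Unique facetList
  facetList-unique = Unique.++⁺
    (Unique.map⁺ (∷ʳ-injectiveʳ (consecutive 1 d) (consecutive 1 d)) (consecutive-unique (suc d) (suc d)))
    (Unique.map⁺ ∷-injectiveˡ (consecutive-unique 2 d))
    fans-windows-disjoint

  facet-increasing : ∀ {X} → IsFacet X → StrictIncr X
  facet-increasing (fan⁺ d<k _) = consecutive-∷ʳ-increasing 1 d d<k
  facet-increasing (window⁺ _ _) = consecutive-increasing _ (suc d)

  facet-size : ∀ {X} → IsFacet X → length X ≡ suc d
  facet-size (fan⁺ {k} _ _) = begin
    length (consecutive 1 d ∷ʳ k)  ≡⟨ length-++ (consecutive 1 d) ⟩
    length (consecutive 1 d) + 1   ≡⟨ cong (_+ 1) (length-consecutive 1 d) ⟩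
    d + 1                          ≡⟨ ℕ.+-comm d 1 ⟩
    suc d                          ∎
    where open ≡-Reasoning
  facet-size (window⁺ _ _) = length-consecutive _ (suc d)

  facet-inRange : ∀ {X} → IsFacet X → All (λ x → 1 ≤ x × x ≤ apex) X
  facet-inRange (fan⁺ d<k k≤apex) = All.tabulate λ x∈fan →
    [ (λ (1≤x , x≤d) → 1≤x , ≤-trans x≤d (<⇒≤ d<apex)) , (λ { refl → ≤-trans (s≤s z≤n) d<k , k≤apex }) ]′
      (∈-fan⁻ x∈fan)
  facet-inRange (window⁺ {i} 2≤i i≤d+1) = All.tabulate λ x∈window →
    let i≤x , x<i+d+1 = ∈-consecutive⁻ i (suc d) x∈window
    in ≤-trans (≤-trans (s≤s z≤n) 2≤i) i≤x , ℕ.≤-pred (ℕ.<-≤-trans x<i+d+1 (ℕ.+-monoˡ-≤ (suc d) i≤d+1))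

  Δ : PureComplex apex d
  Δ = record
    { facets     = facetList
    ; nonempty   = λ ()
    ; distinct   = facetList-unique
    ; increasing = All.tabulate λ X∈Δ → facet-increasing (∈-facetList⁻ X∈Δ)
    ; size       = All.tabulate λ X∈Δ → facet-size (∈-facetList⁻ X∈Δ)
    ; inRange    = All.tabulate λ X∈Δ → facet-inRange (∈-facetList⁻ X∈Δ)
    }

  base : List ℕ
  base = fan (suc d)

  base∈Δ : base ∈ facetList
  base∈Δ = ∈-facetList⁺ (fan⁺ ≤-refl d<apex)

  window₁≡base : window 1 ≡ base
  window₁≡base = sym (consecutive-∷ʳ 1 d)

  window∈Δ : ∀ {j} → 1 ≤ j → j ≤ suc d → window j ∈ facetList
  window∈Δ {1} _ _ = subst (_∈ facetList) (sym window₁≡base) base∈Δ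
  window∈Δ {suc (suc j)} _ j+2≤d+1 = ∈-facetList⁺ (window⁺ (s≤s (s≤s z≤n)) j+2≤d+1)

  window-walk : ∀ j → 1 ≤ j → j ≤ suc d → Star (DualEdge Δ) (window j) base
  window-walk 1 _ _ = subst (λ X → Star (DualEdge Δ) X base) (sym window₁≡base) ε
  window-walk (suc (suc j)) _ j+2≤d+1 = step ◅ window-walk (suc j) (s≤s z≤n) j+1≤d+1
    where
    j+1≤d+1 : suc j ≤ suc d
    j+1≤d+1 = ≤-trans (ℕ.n≤1+n _) j+2≤d+1
    step : DualEdge Δ (window (suc (suc j))) (window (suc j))
    step = window∈Δ (s≤s z≤n) j+2≤d+1 , window∈Δ (s≤s z≤n) j+1≤d+1 ,
           consecutive (suc (suc j)) d , consecutive-increasing _ d ,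
           consecutive-⊆-suc _ d , there , length-consecutive _ d

  walk-to-base : ∀ {X} → X ∈ facetList → Star (DualEdge Δ) X base
  walk-to-base X∈Δ with ∈-facetList⁻ X∈Δ
  ... | fan⁺ _ _ =
    (X∈Δ , base∈Δ , consecutive 1 d , consecutive-increasing 1 d , ∈-++⁺ˡ , ∈-++⁺ˡ , length-consecutive 1 d) ◅ ε
  ... | window⁺ 2≤i i≤d+1 = window-walk _ (≤-trans (s≤s z≤n) 2≤i) i≤d+1

  strongly-connected : StronglyConnected Δ
  strongly-connected _ _ X∈Δ Y∈Δ = walk-to-base X∈Δ ◅◅ reverse (DualEdge-sym {Δ = Δ}) (walk-to-base Y∈Δ)

  interval-order : IntervalOrder Δ
  interval-order v₀ vs ws v₀vs∈Δ v₀ws↑ ws≤vs with ∈-facetList⁻ v₀vs∈Δ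
  ... | fan⁺ d<k k≤apex with consecutive-∷ʳ-forced 1 e v₀ws↑ ws≤vs
  ... | w , refl , d<w , w≤k = ∈-facetList⁺ (fan⁺ d<w (≤-trans w≤k k≤apex))
  interval-order v₀ vs ws v₀vs∈Δ v₀ws↑ ws≤vs | window⁺ 2≤i i≤d+1
    with consecutive-forced _ d v₀ws↑ ws≤vs
  ... | refl = ∈-facetList⁺ (window⁺ 2≤i i≤d+1)

  apex-facets : ∀ {Z} → Z ∈ facetList → apex ∈ Z → Z ≡ fan apex ⊎ Z ≡ window (suc d)
  apex-facets Z∈Δ apex∈Z with ∈-facetList⁻ Z∈Δ
  ... | fan⁺ _ _ with ∈-fan⁻ apex∈Z
  ... | inj₁ (_ , apex≤d) = ⊥-elim (<⇒≱ d<apex apex≤d)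
  ... | inj₂ refl = inj₁ refl
  apex-facets Z∈Δ apex∈Z | window⁺ _ i≤d+1 with ∈-consecutive⁻ _ (suc d) apex∈Z
  ... | _ , apex<i+d+1 = inj₂ (cong window (ℕ.≤-antisym i≤d+1 (ℕ.+-cancelʳ-< (suc d) d _ apex<i+d+1)))

  fan∩window⊆apex : ∀ {x} → x ∈ fan apex → x ∈ window (suc d) → x ≡ apex
  fan∩window⊆apex x∈fan x∈window with ∈-fan⁻ x∈fan
  ... | inj₂ x≡apex = x≡apex
  ... | inj₁ (_ , x≤d) = ⊥-elim (<⇒≱ (proj₁ (∈-consecutive⁻ (suc d) (suc d) x∈window)) x≤d)

  not-shellable : 1 ≤ e → ¬ Shellable Δ
  not-shellable 1≤e = pinched⇒¬shellable Δ (s≤s 1≤e)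
    (∈-facetList⁺ (fan⁺ d<apex ≤-refl)) (∈-facetList⁺ (window⁺ (s≤s (s≤s z≤n)) ≤-refl)) (λ ())
    apex-facets (∈-++⁺ʳ (consecutive 1 d) (here refl)) (∈-consecutive⁺ (suc d) (suc d) d<apex ≤-refl)
    fan∩window⊆apex

interval-order-without-shelling : (d : ℕ) → 2 ≤ d →
  Σ ℕ λ n → Σ (PureComplex n d) λ Δ → StronglyConnected Δ × IntervalOrder Δ × ¬ Shellable Δ
interval-order-without-shelling (suc e) (s≤s 1≤e) =
  apex , Δ , strongly-connected , interval-order , not-shellable 1≤e
  where open Counterexample e

theorem3p5 :
    ((n : ℕ) (Δ : PureComplex n 1) → StronglyConnected Δ → IntervalOrder Δ →
      (Fs : List (List ℕ)) → Fs ↭ facets Δ → LexOrdered Fs → IsShelling Δ Fs)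
    ×
    ((d : ℕ) → 2 ≤ d →
      Σ ℕ λ n → Σ (PureComplex n d) λ Δ →
        StronglyConnected Δ × IntervalOrder Δ × ¬ Shellable Δ)
theorem3p5 = lex-order-shells-graph , interval-order-without-shelling
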